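{- Let $q$ be a prime power and $\mathcal{Q}=\mathbb{F}_q^3$ with commuting relation $(x_1,y_1,z_1)$ commutes with $(x_2,y_2,z_2)$ iff $x_1y_2-y_1x_2=z_1-z_2$. Then there exist three lines $L_1,L_2,L_3$ in $\mathcal{Q}$ and a non-commuting subset of $L_1\cup L_2\cup L_3$ of size at least $3q-3$. Moreover, if $q>3$ and $\mathrm{char}(\mathbb{F}_q)\neq 2$, there exists a non-commuting subset of $\mathcal{Q}$ of size $3q-2$ which is not contained in a union of three lines.
   Context: A subset of $\mathcal{Q}$ is non-commuting if no two distinct elements commute. A line is a set $\{(x_0+at,y_0+bt,z_0+ct)\mid t\in\mathbb{F}_q\}$ with $(a,b,c)\neq 0$. -}

module Defs where

open import Level using (0ℓ)
open import Data.Nat using (ℕ)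
open import Data.Fin using (Fin)
open import Data.Product using (Σ; ∃; _×_; _,_)
open import Data.Sum using (_⊎_)
open import Data.List using (List; length)
open import Data.List.Membership.Propositional using (_∈_)
open import Data.List.Relation.Unary.All using (All)
open import Data.List.Relation.Unary.Unique.Propositional using (Unique)
open import Relation.Nullary using (¬_)
open import Relation.Binary.PropositionalEquality using (_≡_; _≢_)
open import Algebra.Core using (Op₁; Op₂)
open import Algebra.Structures using (IsCommutativeRing)
open import Function.Bundles using (_↔_)

record FiniteField : Set₁ where
  infixl 7 _*_
  infixl 6 _+_ _-_
  field
    Carrier : Set
    _+_ _*_ : Op₂ Carrier
    -_      : Op₁ Carrier
    0# 1#   : Carrier
    isCommutativeRing : IsCommutativeRing _≡_ _+_ _*_ -_ 0# 1#
    0≢1     : 0# ≢ 1#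
    inverse : ∀ x → x ≢ 0# → ∃ λ y → x * y ≡ 1#
    size    : ℕ
    enum    : Fin size ↔ Carrier

  _-_ : Op₂ Carrier
  x - y = x + (- y)

module _ (F : FiniteField) where
  open FiniteField F

  Point : Set
  Point = Carrier × Carrier × Carrier

  Commutes : Point → Point → Set
  Commutes (x₁ , y₁ , z₁) (x₂ , y₂ , z₂) = x₁ * y₂ - y₁ * x₂ ≡ z₁ - z₂

  -- a finite subset of 𝒬 given as a duplicate-free list
  NonCommuting : List Point → Set
  NonCommuting S = ∀ p p′ → p ∈ S → p′ ∈ S → p ≢ p′ → ¬ Commutes p p′

  record Line : Set where
    constructor line
    field
      base : Point
      dir  : Point
      dir≢0 : dir ≢ (0# , 0# , 0#)

  OnLine : Line → Point → Set
  OnLine (line (x₀ , y₀ , z₀) (a , b , c) _) p =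
    ∃ λ t → p ≡ (x₀ + a * t , y₀ + b * t , z₀ + c * t)

  InUnion3 : Line → Line → Line → Point → Set
  InUnion3 L₁ L₂ L₃ p = OnLine L₁ p ⊎ OnLine L₂ p ⊎ OnLine L₃ p

module Submission where

-- The point (s , a , c s) lies on the line through (0 , a , 0) with
-- direction (1 , 0 , c), and two such points commute iff s (a′ − c) = s′ (a − c′).
-- So for distinct a₀, a₁, a₂ the rows {(s , aᵢ , aᵢ₊₁ s) | s ≠ 0}, indices mod 3,
-- form a non-commuting set of 3(q − 1) points on three lines, which is (i) for
-- q ≥ 3 (three explicit points settle q < 3); the point (0 , b , 0) with
-- b ∉ {aᵢ} commutes with none of them, giving 3q − 2 points.
--
-- For (a₀, a₁, a₂) = (−1, 0, 1) seven of these points have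
-- no three collinear: for each triple some coordinate of the cross product
-- normalises to a product of nonzero factors.  Three covering lines colour the
-- seven points with three colours, and a monochromatic triple (found by
-- exhaustive search over all 3⁷ colourings) would be collinear.

open import Defs
open import Level using (0ℓ)
open import Data.Nat as ℕ using (ℕ; zero; suc; _≤_; _<_; _∸_; z≤n; s≤s)
import Data.Nat.Properties as ℕP
open import Data.Integer as ℤ using (ℤ; -[1+_]; _⊖_)
import Data.Integer.Properties as ℤP
open import Data.Sign as Sign using (Sign)
open import Data.Maybe using (Maybe; just; nothing)
open import Data.Fin as Fin using (Fin; punchIn; punchOut; #_)
import Data.Fin.Properties as FinP
open import Data.Product using (Σ; ∃; ∃₂; _×_; _,_; proj₁; proj₂)
open import Data.Sum using (_⊎_; inj₁; inj₂)
open import Data.Empty using (⊥; ⊥-elim)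
open import Data.List as List using (List; []; _∷_; _++_; map; length)
import Data.List.Properties as ListP
open import Data.List.Membership.Propositional using (_∈_; find)
open import Data.List.Membership.Propositional.Properties
  using (∈-map⁺; ∈-map⁻; ∈-++⁺ˡ; ∈-++⁺ʳ; ∈-++⁻; ∈-allFin; ∈-cartesianProductWith⁺; ∈-cartesianProductWith⁻)
import Data.List.Relation.Unary.Any as Any
open import Data.List.Relation.Unary.Any using (Any; here; there)
open import Data.Vec as Vec using (Vec) renaming (_∷_ to _∷ᵥ_; [] to []ᵥ)
import Data.Vec.Properties as VecP
open import Data.Vec.N-ary using (N-ary)
open import Relation.Nullary.Decidable using (toWitness; _×-dec_)
import Data.List.Relation.Unary.AllPairs as AllPairs
open import Data.List.Relation.Unary.All as All using (All)
open import Data.List.Relation.Unary.Unique.Propositional using (Unique)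
import Data.List.Relation.Unary.Unique.Propositional.Properties as UniqueP
open import Relation.Nullary using (¬_; Dec; yes; no)
open import Relation.Binary.PropositionalEquality
open import Algebra.Core using (Op₁; Op₂)
open import Algebra.Bundles using (CommutativeRing)
open import Algebra.Structures using (IsCommutativeRing)
import Algebra.Solver.Ring.AlmostCommutativeRing as ACR
import Algebra.Solver.Ring.NaturalCoefficients.Default as NatSolver
import Algebra.Solver.Ring
open import Function using (_∘_)
open import Function.Bundles using (Inverse)

-- A ring solver with integer coefficients for any commutative ring whose
-- equality is propositional.  It rests on the canonical homomorphism ℤ → A.
module IntegerCoefficients
  {A : Set} {add mul : Op₂ A} {neg : Op₁ A} {0ᴬ 1ᴬ : A}
  (isCR : IsCommutativeRing _≡_ add mul neg 0ᴬ 1ᴬ) where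

  commutativeRing : CommutativeRing 0ℓ 0ℓ
  commutativeRing = record { isCommutativeRing = isCR }

  open CommutativeRing commutativeRing
    using (_+_; _*_; -_; 0#; 1#; semiring; commutativeSemiring; ring; +-abelianGroup)
  open IsCommutativeRing isCR
    using (+-comm; +-identityˡ; +-identityʳ; -‿inverseʳ; *-identityˡ; *-identityʳ; zeroʳ)
  open import Algebra.Properties.Semiring.Mult.TCOptimised semiring
    using (1+×; ×-homo-+; ×1-homo-*) renaming (_×_ to _times_)
  open import Algebra.Properties.Ring ring using (-1*x≈-x; -0#≈0#; -‿involutive)
  open import Algebra.Properties.AbelianGroup +-abelianGroup using (⁻¹-∙-comm)
  module N = NatSolver commutativeSemiring
  open ≡-Reasoning

  -- the image n · 1 of a natural number; the optimised multiplication makes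
  -- 1 ↦ 1# and 2 ↦ 1# + 1# definitionally, so solver constants evaluate to these
  ι : ℕ → A
  ι n = n times 1#

  ⟦_⟧ℤ : ℤ → A
  ⟦ ℤ.+ n ⟧ℤ = ι n
  ⟦ -[1+ n ] ⟧ℤ = - ι (suc n)

  shift-difference : ∀ a b → (1# + a) + - (1# + b) ≡ a + - b
  shift-difference a b = begin
    (1# + a) + - (1# + b)      ≡⟨ cong ((1# + a) +_) (sym (⁻¹-∙-comm 1# b)) ⟩
    (1# + a) + (- 1# + - b)    ≡⟨ N.solve 4 (λ o a mo mb → (o N.:+ a) N.:+ (mo N.:+ mb) N.:= (a N.:+ mb) N.:+ (o N.:+ mo)) refl 1# a (- 1#) (- b) ⟩
    (a + - b) + (1# + - 1#)    ≡⟨ cong ((a + - b) +_) (-‿inverseʳ 1#) ⟩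
    (a + - b) + 0#             ≡⟨ +-identityʳ _ ⟩
    a + - b                    ∎

  ⊖-homo : ∀ m n → ⟦ m ⊖ n ⟧ℤ ≡ ι m + - ι n
  ⊖-homo m zero = begin
    ⟦ m ⊖ zero ⟧ℤ ≡⟨ cong ⟦_⟧ℤ (ℤP.⊖-≥ {m} {0} z≤n) ⟩
    ι m           ≡⟨ sym (+-identityʳ _) ⟩
    ι m + 0#      ≡⟨ cong (ι m +_) (sym -0#≈0#) ⟩
    ι m + - 0#    ∎
  ⊖-homo zero (suc n) = sym (+-identityˡ _)
  ⊖-homo (suc m) (suc n) = begin
    ⟦ suc m ⊖ suc n ⟧ℤ          ≡⟨ cong ⟦_⟧ℤ (ℤP.[1+m]⊖[1+n]≡m⊖n m n) ⟩
    ⟦ m ⊖ n ⟧ℤ                  ≡⟨ ⊖-homo m n ⟩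
    ι m + - ι n                 ≡⟨ sym (shift-difference (ι m) (ι n)) ⟩
    (1# + ι m) + - (1# + ι n)   ≡⟨ sym (cong₂ (λ a b → a + - b) (1+× m 1#) (1+× n 1#)) ⟩
    ι (suc m) + - ι (suc n)     ∎

  +-homo : ∀ i j → ⟦ i ℤ.+ j ⟧ℤ ≡ ⟦ i ⟧ℤ + ⟦ j ⟧ℤ
  +-homo (ℤ.+ m) (ℤ.+ n) = ×-homo-+ 1# m n
  +-homo (ℤ.+ m) -[1+ n ] = ⊖-homo m (suc n)
  +-homo -[1+ m ] (ℤ.+ n) = trans (⊖-homo n (suc m)) (+-comm _ _)
  +-homo -[1+ m ] -[1+ n ] = begin
    - ι (suc (suc (m ℕ.+ n)))  ≡⟨ cong (λ k → - ι (suc k)) (sym (ℕP.+-suc m n)) ⟩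
    - ι (suc m ℕ.+ suc n)      ≡⟨ cong -_ (×-homo-+ 1# (suc m) (suc n)) ⟩
    - (ι (suc m) + ι (suc n))  ≡⟨ sym (⁻¹-∙-comm _ _) ⟩
    - ι (suc m) + - ι (suc n)  ∎

  -‿homo : ∀ i → ⟦ ℤ.- i ⟧ℤ ≡ - ⟦ i ⟧ℤ
  -‿homo (ℤ.+ zero) = sym -0#≈0#
  -‿homo (ℤ.+ suc n) = refl
  -‿homo -[1+ n ] = sym (-‿involutive _)

  signValue : Sign → A
  signValue Sign.+ = 1#
  signValue Sign.- = - 1#

  signValue-* : ∀ s t → signValue (s Sign.* t) ≡ signValue s * signValue t
  signValue-* Sign.+ Sign.+ = sym (*-identityˡ 1#)
  signValue-* Sign.+ Sign.- = sym (*-identityˡ _)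
  signValue-* Sign.- Sign.+ = sym (*-identityʳ _)
  signValue-* Sign.- Sign.- = trans (sym (-‿involutive 1#)) (sym (-1*x≈-x (- 1#)))

  ◃-homo : ∀ s n → ⟦ s ℤ.◃ n ⟧ℤ ≡ signValue s * ι n
  ◃-homo s zero = sym (zeroʳ _)
  ◃-homo Sign.+ (suc n) = sym (*-identityˡ _)
  ◃-homo Sign.- (suc n) = sym (-1*x≈-x _)

  sign-abs : ∀ i → ⟦ i ⟧ℤ ≡ signValue (ℤ.sign i) * ι ℤ.∣ i ∣
  sign-abs (ℤ.+ n) = sym (*-identityˡ _)
  sign-abs -[1+ n ] = sym (-1*x≈-x _)

  *-homo : ∀ i j → ⟦ i ℤ.* j ⟧ℤ ≡ ⟦ i ⟧ℤ * ⟦ j ⟧ℤ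
  *-homo i j = begin
    ⟦ (σ Sign.* τ) ℤ.◃ (∣i∣ ℕ.* ∣j∣) ⟧ℤ              ≡⟨ ◃-homo (σ Sign.* τ) (∣i∣ ℕ.* ∣j∣) ⟩
    signValue (σ Sign.* τ) * ι (∣i∣ ℕ.* ∣j∣)           ≡⟨ cong₂ _*_ (signValue-* σ τ) (×1-homo-* ∣i∣ ∣j∣) ⟩
    (signValue σ * signValue τ) * (ι ∣i∣ * ι ∣j∣)      ≡⟨ N.solve 4 (λ a b c d → (a N.:* b) N.:* (c N.:* d) N.:= (a N.:* c) N.:* (b N.:* d)) refl _ _ _ _ ⟩
    (signValue σ * ι ∣i∣) * (signValue τ * ι ∣j∣)      ≡⟨ sym (cong₂ _*_ (sign-abs i) (sign-abs j)) ⟩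
    ⟦ i ⟧ℤ * ⟦ j ⟧ℤ                                      ∎
    where
    σ = ℤ.sign i
    τ = ℤ.sign j
    ∣i∣ = ℤ.∣ i ∣
    ∣j∣ = ℤ.∣ j ∣

  integerMorphism : ℤ.+-*-rawRing ACR.-Raw-AlmostCommutative⟶ ACR.fromCommutativeRing commutativeRing
  integerMorphism = record
    { ⟦_⟧ = ⟦_⟧ℤ ; +-homo = +-homo ; *-homo = *-homo ; -‿homo = -‿homo ; 0-homo = refl ; 1-homo = refl }

  coefficient≟ : ∀ i j → Maybe (⟦ i ⟧ℤ ≡ ⟦ j ⟧ℤ)
  coefficient≟ i j with i ℤ.≟ j
  ... | yes i≡j = just (cong ⟦_⟧ℤ i≡j)
  ... | no _ = nothing

  open Algebra.Solver.Ring ℤ.+-*-rawRing (ACR.fromCommutativeRing commutativeRing) integerMorphism coefficient≟ public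
    using (Polynomial; con; var; _:+_; _:*_; _:-_; :-_; _:=_; ⟦_⟧; ⟦_⟧↓; solve; prove)

-- Coordinate k of the cross product (q − p) × (r − p), written once over an
-- arbitrary ring signature so that evaluating its polynomial instance gives
-- its field instance definitionally.
module CrossProduct {X : Set} (_⊕_ _⊗_ : Op₂ X) (⊖_ : Op₁ X) where

  private
    _−_ : Op₂ X
    u − v = u ⊕ (⊖ v)

    det : X → X → X → X → X
    det u v u′ v′ = (u ⊗ v) − (u′ ⊗ v′)

  cross : Fin 3 → X × X × X → X × X × X → X × X × X → X
  cross Fin.zero (x₁ , y₁ , z₁) (x₂ , y₂ , z₂) (x₃ , y₃ , z₃) =
    det (y₂ − y₁) (z₃ − z₁) (z₂ − z₁) (y₃ − y₁)
  cross (Fin.suc Fin.zero) (x₁ , y₁ , z₁) (x₂ , y₂ , z₂) (x₃ , y₃ , z₃) =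
    det (z₂ − z₁) (x₃ − x₁) (x₂ − x₁) (z₃ − z₁)
  cross (Fin.suc (Fin.suc Fin.zero)) (x₁ , y₁ , z₁) (x₂ , y₂ , z₂) (x₃ , y₃ , z₃) =
    det (x₂ − x₁) (y₃ − y₁) (y₂ − y₁) (x₃ − x₁)

length-cartesianProductWith : ∀ {A B C : Set} (f : A → B → C) xs ys →
  length (List.cartesianProductWith f xs ys) ≡ length xs ℕ.* length ys
length-cartesianProductWith f [] ys = refl
length-cartesianProductWith f (x ∷ xs) ys = begin
  length (map (f x) ys ++ List.cartesianProductWith f xs ys)        ≡⟨ ListP.length-++ (map (f x) ys) ⟩
  length (map (f x) ys) ℕ.+ length (List.cartesianProductWith f xs ys) ≡⟨ cong₂ ℕ._+_ (ListP.length-map (f x) ys) (length-cartesianProductWith f xs ys) ⟩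
  length ys ℕ.+ length xs ℕ.* length ys                             ∎
  where open ≡-Reasoning

next : Fin 3 → Fin 3
next Fin.zero = Fin.suc Fin.zero
next (Fin.suc Fin.zero) = Fin.suc (Fin.suc Fin.zero)
next (Fin.suc (Fin.suc Fin.zero)) = Fin.zero

cyclic : ∀ i j → j ≡ i ⊎ j ≡ next i ⊎ i ≡ next j
cyclic Fin.zero Fin.zero = inj₁ refl
cyclic Fin.zero (Fin.suc Fin.zero) = inj₂ (inj₁ refl)
cyclic Fin.zero (Fin.suc (Fin.suc Fin.zero)) = inj₂ (inj₂ refl)
cyclic (Fin.suc Fin.zero) Fin.zero = inj₂ (inj₂ refl)
cyclic (Fin.suc Fin.zero) (Fin.suc Fin.zero) = inj₁ refl
cyclic (Fin.suc Fin.zero) (Fin.suc (Fin.suc Fin.zero)) = inj₂ (inj₁ refl)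
cyclic (Fin.suc (Fin.suc Fin.zero)) Fin.zero = inj₂ (inj₁ refl)
cyclic (Fin.suc (Fin.suc Fin.zero)) (Fin.suc Fin.zero) = inj₂ (inj₂ refl)
cyclic (Fin.suc (Fin.suc Fin.zero)) (Fin.suc (Fin.suc Fin.zero)) = inj₁ refl

next-≢ : ∀ i → next i ≢ i
next-≢ Fin.zero ()
next-≢ (Fin.suc Fin.zero) ()
next-≢ (Fin.suc (Fin.suc Fin.zero)) ()

next²-≢ : ∀ i → next (next i) ≢ i
next²-≢ Fin.zero ()
next²-≢ (Fin.suc Fin.zero) ()
next²-≢ (Fin.suc (Fin.suc Fin.zero)) ()

three-rows-plus-one : ∀ {q} → 0 < q → 3 ℕ.* (q ∸ 1) ℕ.+ 1 ≡ 3 ℕ.* q ∸ 2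
three-rows-plus-one {suc n} _ = trans (ℕP.+-comm (3 ℕ.* n) 1) (cong (_∸ 2) (sym (ℕP.*-suc 3 n)))

Triple : Set
Triple = Fin 7 × Fin 7 × Fin 7

increasingTriples : List Triple
increasingTriples = List.filter (λ (i , j , k) → (i Fin.<? j) ×-dec (j Fin.<? k))
  (List.cartesianProduct (List.allFin 7) (List.cartesianProduct (List.allFin 7) (List.allFin 7)))

Monochromatic : (Fin 7 → Fin 3) → Triple → Set
Monochromatic colour (i , j , k) = colour j ≡ colour i × colour k ≡ colour i

monochromatic? : ∀ colour t → Dec (Monochromatic colour t)
monochromatic? colour (i , j , k) = (colour j Fin.≟ colour i) ×-dec (colour k Fin.≟ colour i)

-- Seven points coloured with three colours contain a monochromatic triple:
-- checked exhaustively over all 3⁷ colourings.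
monochromatic-triple : ∀ colour → Any (Monochromatic colour) increasingTriples
monochromatic-triple colour = Any.map agree (decide (Vec.tabulate colour))
  where
  decide : (v : Vec (Fin 3) 7) → Any (Monochromatic (Vec.lookup v)) increasingTriples
  decide (c₀ ∷ᵥ c₁ ∷ᵥ c₂ ∷ᵥ c₃ ∷ᵥ c₄ ∷ᵥ c₅ ∷ᵥ c₆ ∷ᵥ []ᵥ) = toWitness {a? = every} _ c₀ c₁ c₂ c₃ c₄ c₅ c₆
    where
    every : Dec (∀ c₀ c₁ c₂ c₃ c₄ c₅ c₆ → Any (Monochromatic (Vec.lookup (c₀ ∷ᵥ c₁ ∷ᵥ c₂ ∷ᵥ c₃ ∷ᵥ c₄ ∷ᵥ c₅ ∷ᵥ c₆ ∷ᵥ []ᵥ))) increasingTriples)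
    every = FinP.all? λ c₀ → FinP.all? λ c₁ → FinP.all? λ c₂ → FinP.all? λ c₃ → FinP.all? λ c₄ → FinP.all? λ c₅ → FinP.all? λ c₆ →
      Any.any? (monochromatic? (Vec.lookup (c₀ ∷ᵥ c₁ ∷ᵥ c₂ ∷ᵥ c₃ ∷ᵥ c₄ ∷ᵥ c₅ ∷ᵥ c₆ ∷ᵥ []ᵥ))) increasingTriples
  agree : ∀ {t} → Monochromatic (Vec.lookup (Vec.tabulate colour)) t → Monochromatic colour t
  agree {i , j , k} (j≡i , k≡i) = trans (sym (l j)) (trans j≡i (l i)) , trans (sym (l k)) (trans k≡i (l i))
    where
    l = VecP.lookup∘tabulate colour

module Construction (F : FiniteField) where
  open FiniteField F using (Carrier; _+_; _*_; -_; _-_; 0#; 1#; 0≢1; inverse; size; enum)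
    renaming (isCommutativeRing to isCR)
  open IsCommutativeRing isCR
    using (-‿inverseʳ; zeroˡ; zeroʳ; +-identityˡ; +-identityʳ; *-identityˡ; *-identityʳ)
  open IntegerCoefficients isCR
    using (commutativeRing; Polynomial; con; var; _:+_; _:*_; _:-_; :-_; _:=_; ⟦_⟧; ⟦_⟧↓; solve; prove)
  open CommutativeRing commutativeRing using (ring; +-group)
  open import Algebra.Properties.Ring ring using (-0#≈0#; -‿involutive)
  open import Algebra.Properties.Group +-group using (x∙y⁻¹≈ε⇒x≈y; inverseˡ-unique)
  open ≡-Reasoning

  difference-zero⇒equal : ∀ {x y} → x - y ≡ 0# → x ≡ y
  difference-zero⇒equal = x∙y⁻¹≈ε⇒x≈y _ _

  transfer : ∀ {X Y U V} → U - V ≡ X - Y → X ≡ Y → U ≡ V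
  transfer {X} eq refl = difference-zero⇒equal (trans eq (-‿inverseʳ X))

  1≢0 : 1# ≢ 0#
  1≢0 = 0≢1 ∘ sym

  product-zero : ∀ {a b} → a * b ≡ 0# → a ≢ 0# → b ≡ 0#
  product-zero {a} {b} ab≡0 a≢0 with inverse a a≢0
  ... | a⁻¹ , aa⁻¹≡1 = begin
    b                 ≡⟨ sym (*-identityʳ b) ⟩
    b * 1#            ≡⟨ cong (b *_) (sym aa⁻¹≡1) ⟩
    b * (a * a⁻¹)     ≡⟨ solve 3 (λ a a⁻¹ b → b :* (a :* a⁻¹) := a⁻¹ :* (a :* b)) refl a a⁻¹ b ⟩
    a⁻¹ * (a * b)     ≡⟨ cong (a⁻¹ *_) ab≡0 ⟩
    a⁻¹ * 0#          ≡⟨ zeroʳ a⁻¹ ⟩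
    0#                ∎

  *-≢0 : ∀ {a b} → a ≢ 0# → b ≢ 0# → a * b ≢ 0#
  *-≢0 a≢0 b≢0 ab≡0 = b≢0 (product-zero ab≡0 a≢0)

  -‿≢0 : ∀ {a} → a ≢ 0# → - a ≢ 0#
  -‿≢0 {a} a≢0 -a≡0 = a≢0 (trans (sym (-‿involutive a)) (trans (cong -_ -a≡0) -0#≈0#))

  cancel-difference : ∀ {s a c} → s * (a - c) ≡ 0# → s ≢ 0# → a ≡ c
  cancel-difference eq s≢0 = difference-zero⇒equal (product-zero eq s≢0)

  self-difference : ∀ s a → s * (a - a) ≡ 0#
  self-difference s a = trans (cong (s *_) (-‿inverseʳ a)) (zeroʳ s)

  *-cancelʳ : ∀ {d s s′} → d ≢ 0# → s * d ≡ s′ * d → s ≡ s′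
  *-cancelʳ {d} {s} {s′} d≢0 eq = cancel-difference (begin
    d * (s - s′)   ≡⟨ solve 3 (λ d s s′ → d :* (s :- s′) := s :* d :- s′ :* d) refl d s s′ ⟩
    s * d - s′ * d ≡⟨ cong (_- s′ * d) eq ⟩
    s′ * d - s′ * d ≡⟨ -‿inverseʳ _ ⟩
    0#             ∎) d≢0

  open Inverse enum using (to; from; strictlyInverseˡ; strictlyInverseʳ)

  to-injective : ∀ {i j} → to i ≡ to j → i ≡ j
  to-injective {i} {j} eq = trans (sym (strictlyInverseʳ i)) (trans (cong from eq) (strictlyInverseʳ j))

  _≟_ : (x y : Carrier) → Dec (x ≡ y)
  x ≟ y with from x Fin.≟ from y
  ... | yes eq = yes (trans (sym (strictlyInverseˡ x)) (trans (cong to eq) (strictlyInverseˡ y)))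
  ... | no neq = no (neq ∘ cong from)

  avoid : ∀ {k} → k < size → (forbidden : Fin k → Carrier) → ∃ λ x → ∀ j → x ≢ forbidden j
  avoid k<q forbidden with FinP.all? (λ i → FinP.any? (λ j → to i ≟ forbidden j))
  ... | no ¬all with FinP.¬∀⟶∃¬ size _ (λ i → FinP.any? (λ j → to i ≟ forbidden j)) ¬all
  ...   | i , missed = to i , λ j eq → missed (j , eq)
  avoid k<q forbidden | yes hit with FinP.pigeonhole k<q (λ i → proj₁ (hit i))
  ... | i , j , i<j , same = ⊥-elim (FinP.<⇒≢ i<j (to-injective (begin
    to i                   ≡⟨ proj₂ (hit i) ⟩
    forbidden (proj₁ (hit i)) ≡⟨ cong forbidden same ⟩
    forbidden (proj₁ (hit j)) ≡⟨ sym (proj₂ (hit j)) ⟩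
    to j                   ∎)))

  allExcept : ∀ {m} → (Fin m → Carrier) → Fin m → List Carrier
  allExcept {suc n} g i = map (g ∘ punchIn i) (List.allFin n)

  allExcept-length : ∀ {m} (g : Fin m → Carrier) i → length (allExcept g i) ≡ m ∸ 1
  allExcept-length {suc n} g i =
    trans (ListP.length-map _ (List.allFin n)) (ListP.length-tabulate {n = n} (λ k → k))

  allExcept-unique : ∀ {m} (g : Fin m → Carrier) → (∀ {i j} → g i ≡ g j → i ≡ j) →
    ∀ i → Unique (allExcept g i)
  allExcept-unique {suc n} g g-injective i =
    UniqueP.map⁺ (λ eq → FinP.punchIn-injective i _ _ (g-injective eq)) (UniqueP.allFin⁺ n)

  allExcept-≢ : ∀ {m} (g : Fin m → Carrier) → (∀ {i j} → g i ≡ g j → i ≡ j) →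
    ∀ i {x} → x ∈ allExcept g i → x ≢ g i
  allExcept-≢ {suc n} g g-injective i x∈ x≡gi with ∈-map⁻ (g ∘ punchIn i) x∈
  ... | j , _ , refl = FinP.punchInᵢ≢i i j (g-injective x≡gi)

  allExcept-∋ : ∀ {m} (g : Fin m → Carrier) i j → j ≢ i → g j ∈ allExcept g i
  allExcept-∋ {suc n} g i j j≢i =
    subst (λ k → g k ∈ allExcept g i) (FinP.punchIn-punchOut i≢j)
      (∈-map⁺ (g ∘ punchIn i) (∈-allFin (punchOut i≢j)))
    where
    i≢j = j≢i ∘ sym

  nonzeros : List Carrier
  nonzeros = allExcept to (from 0#)

  nonzeros-length : length nonzeros ≡ size ∸ 1
  nonzeros-length = allExcept-length to (from 0#)

  nonzeros-unique : Unique nonzeros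
  nonzeros-unique = allExcept-unique to to-injective (from 0#)

  ∈nonzeros⇒≢0 : ∀ {x} → x ∈ nonzeros → x ≢ 0#
  ∈nonzeros⇒≢0 x∈ x≡0 = allExcept-≢ to to-injective (from 0#) x∈ (trans x≡0 (sym (strictlyInverseˡ 0#)))

  ≢0⇒∈nonzeros : ∀ {x} → x ≢ 0# → x ∈ nonzeros
  ≢0⇒∈nonzeros {x} x≢0 = subst (_∈ nonzeros) (strictlyInverseˡ x)
    (allExcept-∋ to (from 0#) (from x) (λ eq → x≢0 (begin
      x             ≡⟨ sym (strictlyInverseˡ x) ⟩
      to (from x)   ≡⟨ cong to eq ⟩
      to (from 0#)  ≡⟨ strictlyInverseˡ 0# ⟩
      0#            ∎)))

  Pt : Set
  Pt = Point F

  rowPoint : Carrier → Carrier → Carrier → Pt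
  rowPoint a c s = (s , a , c * s)

  rowLine : Carrier → Carrier → Line F
  rowLine a c = line (0# , a , 0#) (1# , 0# , c) (1≢0 ∘ cong proj₁)

  rowPoint-onLine : ∀ a c s → OnLine F (rowLine a c) (rowPoint a c s)
  rowPoint-onLine a c s = s , cong₂ _,_ (sym x≡) (cong₂ _,_ (sym y≡) (sym (+-identityˡ (c * s))))
    where
    x≡ : 0# + 1# * s ≡ s
    x≡ = trans (+-identityˡ _) (*-identityˡ s)
    y≡ : a + 0# * s ≡ a
    y≡ = trans (cong (a +_) (zeroˡ s)) (+-identityʳ a)

  rowPoints-commute : ∀ {a c s a′ c′ s′} → Commutes F (rowPoint a c s) (rowPoint a′ c′ s′) →
    s * (a′ - c) ≡ s′ * (a - c′)
  rowPoints-commute {a} {c} {s} {a′} {c′} {s′} = transfer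
    (solve 6 (λ a c s a′ c′ s′ →
        s :* (a′ :- c) :- s′ :* (a :- c′) := (s :* a′ :- a :* s′) :- (c :* s :- c′ :* s′))
      refl a c s a′ c′ s′)

  module Rows (a : Fin 3 → Carrier) (a-injective : ∀ {i j} → a i ≡ a j → i ≡ j) where

    point : Fin 3 → Carrier → Pt
    point i = rowPoint (a i) (a (next i))

    rowLines : Fin 3 → Line F
    rowLines i = rowLine (a i) (a (next i))

    a-next²-≢ : ∀ i → a i ≢ a (next (next i))
    a-next²-≢ i = next²-≢ i ∘ sym ∘ a-injective

    same-row : ∀ i {s s′} → Commutes F (point i s) (point i s′) → s ≡ s′
    same-row i h = *-cancelʳ (λ eq → next-≢ i (sym (a-injective (difference-zero⇒equal eq))))
      (rowPoints-commute h)

    forward : ∀ i {s s′} → s′ ≢ 0# → ¬ Commutes F (point i s) (point (next i) s′)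
    forward i {s} s′≢0 h = a-next²-≢ i
      (cancel-difference (trans (sym (rowPoints-commute h)) (self-difference s (a (next i)))) s′≢0)

    backward : ∀ i {s s′} → s ≢ 0# → ¬ Commutes F (point (next i) s) (point i s′)
    backward i {s} {s′} s≢0 h = a-next²-≢ i
      (cancel-difference (trans (rowPoints-commute h) (self-difference s′ (a (next i)))) s≢0)

    points-apart : ∀ i j {s s′} → s ≢ 0# → s′ ≢ 0# → point i s ≢ point j s′ →
      ¬ Commutes F (point i s) (point j s′)
    points-apart i j s≢0 s′≢0 p≢p′ h with cyclic i j
    ... | inj₁ refl = p≢p′ (cong (point i) (same-row i h))
    ... | inj₂ (inj₁ refl) = forward i s′≢0 h
    ... | inj₂ (inj₂ refl) = backward j s≢0 h

    rows : List Pt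
    rows = List.cartesianProductWith point (List.allFin 3) nonzeros

    IsRowPoint : Pt → Set
    IsRowPoint p = ∃₂ λ i s → s ≢ 0# × p ≡ point i s

    row-member : ∀ {p} → p ∈ rows → IsRowPoint p
    row-member p∈ with ∈-cartesianProductWith⁻ point (List.allFin 3) nonzeros p∈
    ... | i , s , _ , s∈ , p≡ = i , s , ∈nonzeros⇒≢0 s∈ , p≡

    rows-nonCommuting : NonCommuting F rows
    rows-nonCommuting p p′ p∈ p′∈ with row-member p∈ | row-member p′∈
    ... | i , s , s≢0 , refl | j , s′ , s′≢0 , refl = points-apart i j s≢0 s′≢0

    rows-unique : Unique rows
    rows-unique = UniqueP.cartesianProductWith⁺ point
      (λ eq → a-injective (cong (proj₁ ∘ proj₂) eq) , cong proj₁ eq)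
      (UniqueP.allFin⁺ 3) nonzeros-unique

    rows-length : length rows ≡ 3 ℕ.* (size ∸ 1)
    rows-length = trans (length-cartesianProductWith point (List.allFin 3) nonzeros)
      (cong (3 ℕ.*_) nonzeros-length)

    InRowLines : Pt → Set
    InRowLines = InUnion3 F (rowLines Fin.zero) (rowLines (Fin.suc Fin.zero)) (rowLines (Fin.suc (Fin.suc Fin.zero)))

    rows-covered : All InRowLines rows
    rows-covered = All.tabulate λ p∈ → covered (row-member p∈)
      where
      covered : ∀ {p} → IsRowPoint p → InRowLines p
      covered (Fin.zero , s , _ , refl) = inj₁ (rowPoint-onLine _ _ s)
      covered (Fin.suc Fin.zero , s , _ , refl) = inj₂ (inj₁ (rowPoint-onLine _ _ s))
      covered (Fin.suc (Fin.suc Fin.zero) , s , _ , refl) = inj₂ (inj₂ (rowPoint-onLine _ _ s))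

    module WithExtraPoint (b : Carrier) (b-new : ∀ i → b ≢ a i) where

      -- the point (0 , b , 0), written as a row point with s = 0
      extra : Pt
      extra = rowPoint b b 0#

      extended : List Pt
      extended = rows ++ extra ∷ []

      -- (0 , b , 0) commutes with no nonzero row point, as b differs from every aᵢ₊₁
      extra-apart : ∀ i {s} → s ≢ 0# → ¬ Commutes F extra (point i s)
      extra-apart i {s} s≢0 h = b-new (next i)
        (cancel-difference (trans (sym (rowPoints-commute h)) (zeroˡ (a i - b))) s≢0)

      apart-extra : ∀ i {s} → s ≢ 0# → ¬ Commutes F (point i s) extra
      apart-extra i {s} s≢0 h = b-new (next i)
        (cancel-difference (trans (rowPoints-commute h) (zeroˡ (a i - b))) s≢0)

      extended-member : ∀ {p} → p ∈ extended → IsRowPoint p ⊎ p ≡ extra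
      extended-member p∈ with ∈-++⁻ rows p∈
      ... | inj₁ p∈rows = inj₁ (row-member p∈rows)
      ... | inj₂ (here p≡) = inj₂ p≡

      extended-nonCommuting : NonCommuting F extended
      extended-nonCommuting p p′ p∈ p′∈ with extended-member p∈ | extended-member p′∈
      ... | inj₁ (i , s , s≢0 , refl) | inj₁ (j , s′ , s′≢0 , refl) = points-apart i j s≢0 s′≢0
      ... | inj₁ (i , s , s≢0 , refl) | inj₂ refl = λ _ → apart-extra i s≢0
      ... | inj₂ refl | inj₁ (j , s′ , s′≢0 , refl) = λ _ → extra-apart j s′≢0
      ... | inj₂ refl | inj₂ refl = λ p≢p → ⊥-elim (p≢p refl)

      extended-unique : Unique extended
      extended-unique = UniqueP.++⁺ rows-unique (All.[] AllPairs.∷ AllPairs.[]) disjoint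
        where
        disjoint : ∀ {p} → ¬ (p ∈ rows × p ∈ extra ∷ [])
        disjoint (p∈ , here refl) with row-member p∈
        ... | i , s , _ , p≡ = b-new i (cong (proj₁ ∘ proj₂) p≡)

      extended-length : length extended ≡ 3 ℕ.* (size ∸ 1) ℕ.+ 1
      extended-length = trans (ListP.length-++ rows) (cong (ℕ._+ 1) rows-length)

  Apart : Pt → Pt → Set
  Apart p p′ = ¬ Commutes F p p′ × ¬ Commutes F p′ p

  rowPoints-apart : ∀ {a c s a′ c′ s′} → s * (a′ - c) - s′ * (a - c′) ≢ 0# →
    Apart (rowPoint a c s) (rowPoint a′ c′ s′)
  rowPoints-apart {a} {c} {s} {a′} {c′} {s′} d≢0 =
      (λ h → d≢0 (trans (cong (_- s′ * (a - c′)) (rowPoints-commute h)) (-‿inverseʳ _)))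
    , (λ h → d≢0 (trans (cong (λ u → s * (a′ - c) - u) (rowPoints-commute h)) (-‿inverseʳ _)))

  commutes-refl : ∀ p → Commutes F p p
  commutes-refl (x , y , z) = solve 3 (λ x y z → x :* y :- y :* x := z :- z) refl x y z

  apart⇒≢ : ∀ {p p′} → Apart p p′ → p ≢ p′
  apart⇒≢ (¬h , _) refl = ¬h (commutes-refl _)

  module ThreePoints {p₁ p₂ p₃} (a₁₂ : Apart p₁ p₂) (a₁₃ : Apart p₁ p₃) (a₂₃ : Apart p₂ p₃) where

    points : List Pt
    points = p₁ ∷ p₂ ∷ p₃ ∷ []

    nonCommuting : NonCommuting F points
    nonCommuting _ _ (here refl) (here refl) p≢p = ⊥-elim (p≢p refl)
    nonCommuting _ _ (here refl) (there (here refl)) _ = proj₁ a₁₂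
    nonCommuting _ _ (here refl) (there (there (here refl))) _ = proj₁ a₁₃
    nonCommuting _ _ (there (here refl)) (here refl) _ = proj₂ a₁₂
    nonCommuting _ _ (there (here refl)) (there (here refl)) p≢p = ⊥-elim (p≢p refl)
    nonCommuting _ _ (there (here refl)) (there (there (here refl))) _ = proj₁ a₂₃
    nonCommuting _ _ (there (there (here refl))) (here refl) _ = proj₂ a₁₃
    nonCommuting _ _ (there (there (here refl))) (there (here refl)) _ = proj₂ a₂₃
    nonCommuting _ _ (there (there (here refl))) (there (there (here refl))) p≢p = ⊥-elim (p≢p refl)

    unique : Unique points
    unique = (apart⇒≢ a₁₂ All.∷ apart⇒≢ a₁₃ All.∷ All.[])
      AllPairs.∷ (apart⇒≢ a₂₃ All.∷ All.[]) AllPairs.∷ All.[] AllPairs.∷ AllPairs.[]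

  -- for q < 3: the points (0 , 0 , 0), (1 , 0 , 1), (1 , 1 , 1), each on its own row line
  smallField : size < 3 → ∃ λ L₁ → ∃ λ L₂ → ∃ λ L₃ → ∃ λ (S : List Pt) →
    Unique S × NonCommuting F S × All (InUnion3 F L₁ L₂ L₃) S × 3 ℕ.* size ∸ 3 ≤ length S
  smallField q<3 =
      rowLine 0# 0# , rowLine 0# 1# , rowLine 1# 1# , points , unique , nonCommuting
    , inj₁ (rowPoint-onLine _ _ _) All.∷ inj₂ (inj₁ (rowPoint-onLine _ _ _)) All.∷ inj₂ (inj₂ (rowPoint-onLine _ _ _)) All.∷ All.[]
    , ℕP.∸-monoˡ-≤ 3 (ℕP.*-monoʳ-≤ 3 (ℕP.≤-pred q<3))
    where
    κ₀ κ₁ : Polynomial 0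
    κ₀ = con (ℤ.+ 0)
    κ₁ = con (ℤ.+ 1)
    unit : ∀ {u} → u ≡ 1# → u ≢ 0#
    unit u≡1 u≡0 = 1≢0 (trans (sym u≡1) u≡0)
    open ThreePoints
      (rowPoints-apart (unit (solve 0 (κ₀ :* (κ₀ :- κ₀) :- κ₁ :* (κ₀ :- κ₁) := κ₁) refl)))
      (rowPoints-apart (unit (solve 0 (κ₀ :* (κ₁ :- κ₀) :- κ₁ :* (κ₀ :- κ₁) := κ₁) refl)))
      (rowPoints-apart (unit (solve 0 (κ₁ :* (κ₁ :- κ₁) :- κ₁ :* (κ₀ :- κ₁) := κ₁) refl)))

  threeRows : 3 ≤ size → ∃ λ L₁ → ∃ λ L₂ → ∃ λ L₃ → ∃ λ (S : List Pt) →
    Unique S × NonCommuting F S × All (InUnion3 F L₁ L₂ L₃) S × 3 ℕ.* size ∸ 3 ≤ length S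
  threeRows 3≤q = rowLines _ , rowLines _ , rowLines _ , rows , rows-unique , rows-nonCommuting , rows-covered
    , ℕP.≤-reflexive (trans (sym (ℕP.*-distribˡ-∸ 3 size 1)) (sym rows-length))
    where
    open Rows (λ i → to (Fin.inject≤ i 3≤q)) (λ eq → FinP.inject≤-injective 3≤q 3≤q _ _ (to-injective eq))

  open CrossProduct _+_ _*_ -_ using (cross)

  crossPoly : ∀ {n} → Fin 3 → Polynomial n × Polynomial n × Polynomial n →
    Polynomial n × Polynomial n × Polynomial n → Polynomial n × Polynomial n × Polynomial n → Polynomial n
  crossPoly = CrossProduct.cross _:+_ _:*_ (λ p → :- p)

  Collinear : Pt → Pt → Pt → Set
  Collinear p q r = ∀ k → cross k p q r ≡ 0#

  onLine⇒collinear : ∀ L {p q r} → OnLine F L p → OnLine F L q → OnLine F L r → Collinear p q r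
  onLine⇒collinear (line (x₀ , y₀ , z₀) (u , v , w) _) (t₁ , refl) (t₂ , refl) (t₃ , refl) = vanishes
    where
    onLineIdentity : Fin 3 → N-ary 9 (Polynomial 9) (Polynomial 9 × Polynomial 9)
    onLineIdentity k x₀ y₀ z₀ u v w t₁ t₂ t₃ =
      crossPoly k (x₀ :+ u :* t₁ , y₀ :+ v :* t₁ , z₀ :+ w :* t₁)
        (x₀ :+ u :* t₂ , y₀ :+ v :* t₂ , z₀ :+ w :* t₂) (x₀ :+ u :* t₃ , y₀ :+ v :* t₃ , z₀ :+ w :* t₃)
      := con (ℤ.+ 0)

    vanishes : ∀ k → cross k (x₀ + u * t₁ , y₀ + v * t₁ , z₀ + w * t₁)
      (x₀ + u * t₂ , y₀ + v * t₂ , z₀ + w * t₂) (x₀ + u * t₃ , y₀ + v * t₃ , z₀ + w * t₃) ≡ 0#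
    vanishes Fin.zero = solve 9 (onLineIdentity Fin.zero) refl x₀ y₀ z₀ u v w t₁ t₂ t₃
    vanishes (Fin.suc Fin.zero) = solve 9 (onLineIdentity (Fin.suc Fin.zero)) refl x₀ y₀ z₀ u v w t₁ t₂ t₃
    vanishes (Fin.suc (Fin.suc Fin.zero)) = solve 9 (onLineIdentity (Fin.suc (Fin.suc Fin.zero))) refl x₀ y₀ z₀ u v w t₁ t₂ t₃

  -- the row parameters (−1, 0, 1) used for part two; distinct once 2 ≠ 0
  standard : Fin 3 → Carrier
  standard Fin.zero = - 1#
  standard (Fin.suc Fin.zero) = 0#
  standard (Fin.suc (Fin.suc Fin.zero)) = 1#

  standard-injective : 1# + 1# ≢ 0# → ∀ {i j} → standard i ≡ standard j → i ≡ j
  standard-injective 2≢0 = injective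
    where
    -1≢0 : - 1# ≢ 0#
    -1≢0 = -‿≢0 1≢0
    -1≢1 : - 1# ≢ 1#
    -1≢1 -1≡1 = 2≢0 (trans (cong (1# +_) (sym -1≡1)) (-‿inverseʳ 1#))
    injective : ∀ {i j} → standard i ≡ standard j → i ≡ j
    injective {Fin.zero} {Fin.zero} _ = refl
    injective {Fin.zero} {Fin.suc Fin.zero} eq = ⊥-elim (-1≢0 eq)
    injective {Fin.zero} {Fin.suc (Fin.suc Fin.zero)} eq = ⊥-elim (-1≢1 eq)
    injective {Fin.suc Fin.zero} {Fin.zero} eq = ⊥-elim (-1≢0 (sym eq))
    injective {Fin.suc Fin.zero} {Fin.suc Fin.zero} _ = refl
    injective {Fin.suc Fin.zero} {Fin.suc (Fin.suc Fin.zero)} eq = ⊥-elim (0≢1 eq)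
    injective {Fin.suc (Fin.suc Fin.zero)} {Fin.zero} eq = ⊥-elim (-1≢1 (sym eq))
    injective {Fin.suc (Fin.suc Fin.zero)} {Fin.suc Fin.zero} eq = ⊥-elim (0≢1 (sym eq))
    injective {Fin.suc (Fin.suc Fin.zero)} {Fin.suc (Fin.suc Fin.zero)} _ = refl

  module SevenPoints (2≢0 : 1# + 1# ≢ 0#) (b : Carrier) (b-new : ∀ i → b ≢ standard i) where
    open Rows standard (standard-injective 2≢0) public
    open WithExtraPoint b b-new public

    PolyPt : Set
    PolyPt = Polynomial 1 × Polynomial 1 × Polynomial 1

    ρ : Vec Carrier 1
    ρ = b ∷ᵥ []ᵥ

    evaluate : PolyPt → Pt
    evaluate (x , y , z) = ⟦ x ⟧ ρ , ⟦ y ⟧ ρ , ⟦ z ⟧ ρ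

    β : Polynomial 1
    β = var Fin.zero

    κ : ℤ → Polynomial 1
    κ = con

    standardPoly : Fin 3 → Polynomial 1
    standardPoly Fin.zero = κ -[1+ 0 ]
    standardPoly (Fin.suc Fin.zero) = κ (ℤ.+ 0)
    standardPoly (Fin.suc (Fin.suc Fin.zero)) = κ (ℤ.+ 1)

    rowPoly : Fin 3 → Polynomial 1 → PolyPt
    rowPoly i s = s , standardPoly i , standardPoly (next i) :* s

    -- (1, −1, 0), (2, −1, 0), (b, 0, b), (−b, 0, −b), (1, 1, −1), (2, 1, −2), (0, b, 0)
    testPoly : Fin 7 → PolyPt
    testPoly Fin.zero = rowPoly (# 0) (κ (ℤ.+ 1))
    testPoly (Fin.suc Fin.zero) = rowPoly (# 0) (κ (ℤ.+ 2))
    testPoly (Fin.suc (Fin.suc Fin.zero)) = rowPoly (# 1) β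
    testPoly (Fin.suc (Fin.suc (Fin.suc Fin.zero))) = rowPoly (# 1) (:- β)
    testPoly (Fin.suc (Fin.suc (Fin.suc (Fin.suc Fin.zero)))) = rowPoly (# 2) (κ (ℤ.+ 1))
    testPoly (Fin.suc (Fin.suc (Fin.suc (Fin.suc (Fin.suc Fin.zero))))) = rowPoly (# 2) (κ (ℤ.+ 2))
    testPoly (Fin.suc (Fin.suc (Fin.suc (Fin.suc (Fin.suc (Fin.suc Fin.zero)))))) = κ (ℤ.+ 0) , β , β :* κ (ℤ.+ 0)

    test : Fin 7 → Pt
    test i = evaluate (testPoly i)

    inRow : ∀ i {s} → s ≢ 0# → point i s ∈ extended
    inRow i s≢0 = ∈-++⁺ˡ (∈-cartesianProductWith⁺ point (∈-allFin i) (≢0⇒∈nonzeros s≢0))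

    test∈ : ∀ i → test i ∈ extended
    test∈ Fin.zero = inRow (# 0) 1≢0
    test∈ (Fin.suc Fin.zero) = inRow (# 0) 2≢0
    test∈ (Fin.suc (Fin.suc Fin.zero)) = inRow (# 1) (b-new (# 1))
    test∈ (Fin.suc (Fin.suc (Fin.suc Fin.zero))) = inRow (# 1) (-‿≢0 (b-new (# 1)))
    test∈ (Fin.suc (Fin.suc (Fin.suc (Fin.suc Fin.zero)))) = inRow (# 2) 1≢0
    test∈ (Fin.suc (Fin.suc (Fin.suc (Fin.suc (Fin.suc Fin.zero))))) = inRow (# 2) 2≢0
    test∈ (Fin.suc (Fin.suc (Fin.suc (Fin.suc (Fin.suc (Fin.suc Fin.zero)))))) = ∈-++⁺ʳ rows (here refl)

    -- nonzero factors of the cross-product coordinates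
    data Factor : Set where
      [2] [-1] [b] [b-1] [b+1] : Factor

    factorPoly : Factor → Polynomial 1
    factorPoly [2] = κ (ℤ.+ 2)
    factorPoly [-1] = κ -[1+ 0 ]
    factorPoly [b] = β
    factorPoly [b-1] = β :- κ (ℤ.+ 1)
    factorPoly [b+1] = β :+ κ (ℤ.+ 1)

    productPoly : List Factor → Polynomial 1
    productPoly [] = κ (ℤ.+ 1)
    productPoly (f ∷ fs) = factorPoly f :* productPoly fs

    factor-≢0 : ∀ f → ⟦ factorPoly f ⟧ ρ ≢ 0#
    factor-≢0 [2] = 2≢0
    factor-≢0 [-1] = -‿≢0 1≢0
    factor-≢0 [b] = b-new (# 1)
    factor-≢0 [b-1] = b-new (# 2) ∘ difference-zero⇒equal
    factor-≢0 [b+1] eq = b-new (# 0) (inverseˡ-unique b 1# eq)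

    product-≢0 : ∀ fs → ⟦ productPoly fs ⟧ ρ ≢ 0#
    product-≢0 [] = 1≢0
    product-≢0 (f ∷ fs) = *-≢0 (factor-≢0 f) (product-≢0 fs)

    cross-evaluate : ∀ k P Q R → ⟦ crossPoly k P Q R ⟧ ρ ≡ cross k (evaluate P) (evaluate Q) (evaluate R)
    cross-evaluate Fin.zero P Q R = refl
    cross-evaluate (Fin.suc Fin.zero) P Q R = refl
    cross-evaluate (Fin.suc (Fin.suc Fin.zero)) P Q R = refl

    notCollinear : ∀ i j k c fs →
      ⟦ crossPoly c (testPoly i) (testPoly j) (testPoly k) ⟧↓ ρ ≡ ⟦ productPoly fs ⟧↓ ρ →
      ¬ Collinear (test i) (test j) (test k)
    notCollinear i j k c fs normal-forms collinear = product-≢0 fs (begin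
      ⟦ productPoly fs ⟧ ρ                                     ≡⟨ sym (prove ρ (crossPoly c (testPoly i) (testPoly j) (testPoly k)) (productPoly fs) normal-forms) ⟩
      ⟦ crossPoly c (testPoly i) (testPoly j) (testPoly k) ⟧ ρ ≡⟨ cross-evaluate c _ _ _ ⟩
      cross c (test i) (test j) (test k)                       ≡⟨ collinear c ⟩
      0#                                                       ∎)

    noThreeCollinear : All (λ (i , j , k) → ¬ Collinear (test i) (test j) (test k)) increasingTriples
    noThreeCollinear =
        notCollinear (# 0) (# 1) (# 2) (# 2) [] refl
      All.∷ notCollinear (# 0) (# 1) (# 3) (# 2) [] refl
      All.∷ notCollinear (# 0) (# 1) (# 4) (# 1) [] refl
      All.∷ notCollinear (# 0) (# 1) (# 5) (# 1) ([2] ∷ []) refl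
      All.∷ notCollinear (# 0) (# 1) (# 6) (# 2) ([b+1] ∷ []) refl
      All.∷ notCollinear (# 0) (# 2) (# 3) (# 0) ([2] ∷ [-1] ∷ [b] ∷ []) refl
      All.∷ notCollinear (# 0) (# 2) (# 4) (# 1) ([b-1] ∷ []) refl
      All.∷ notCollinear (# 0) (# 2) (# 5) (# 0) ([2] ∷ [-1] ∷ [b+1] ∷ []) refl
      All.∷ notCollinear (# 0) (# 2) (# 6) (# 1) ([-1] ∷ [b] ∷ []) refl
      All.∷ notCollinear (# 0) (# 3) (# 4) (# 1) ([-1] ∷ [b+1] ∷ []) refl
      All.∷ notCollinear (# 0) (# 3) (# 5) (# 0) ([2] ∷ [b-1] ∷ []) refl
      All.∷ notCollinear (# 0) (# 3) (# 6) (# 1) ([b] ∷ []) refl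
      All.∷ notCollinear (# 0) (# 4) (# 5) (# 0) ([2] ∷ [-1] ∷ []) refl
      All.∷ notCollinear (# 0) (# 4) (# 6) (# 1) [] refl
      All.∷ notCollinear (# 0) (# 5) (# 6) (# 1) ([2] ∷ []) refl
      All.∷ notCollinear (# 1) (# 2) (# 3) (# 0) ([2] ∷ [-1] ∷ [b] ∷ []) refl
      All.∷ notCollinear (# 1) (# 2) (# 4) (# 1) ([2] ∷ [-1] ∷ []) refl
      All.∷ notCollinear (# 1) (# 2) (# 5) (# 0) ([2] ∷ [-1] ∷ [b+1] ∷ []) refl
      All.∷ notCollinear (# 1) (# 2) (# 6) (# 1) ([2] ∷ [-1] ∷ [b] ∷ []) refl
      All.∷ notCollinear (# 1) (# 3) (# 4) (# 1) ([2] ∷ [-1] ∷ []) refl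
      All.∷ notCollinear (# 1) (# 3) (# 5) (# 0) ([2] ∷ [b-1] ∷ []) refl
      All.∷ notCollinear (# 1) (# 3) (# 6) (# 1) ([2] ∷ [b] ∷ []) refl
      All.∷ notCollinear (# 1) (# 4) (# 5) (# 0) ([2] ∷ [-1] ∷ []) refl
      All.∷ notCollinear (# 1) (# 4) (# 6) (# 1) ([2] ∷ []) refl
      All.∷ notCollinear (# 1) (# 5) (# 6) (# 1) ([2] ∷ [2] ∷ []) refl
      All.∷ notCollinear (# 2) (# 3) (# 4) (# 0) ([2] ∷ [b] ∷ []) refl
      All.∷ notCollinear (# 2) (# 3) (# 5) (# 0) ([2] ∷ [b] ∷ []) refl
      All.∷ notCollinear (# 2) (# 3) (# 6) (# 0) ([2] ∷ [b] ∷ [b] ∷ []) refl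
      All.∷ notCollinear (# 2) (# 4) (# 5) (# 0) ([-1] ∷ []) refl
      All.∷ notCollinear (# 2) (# 4) (# 6) (# 1) ([2] ∷ [b] ∷ []) refl
      All.∷ notCollinear (# 2) (# 5) (# 6) (# 1) ([2] ∷ [2] ∷ [b] ∷ []) refl
      All.∷ notCollinear (# 3) (# 4) (# 5) (# 0) ([-1] ∷ []) refl
      All.∷ notCollinear (# 3) (# 4) (# 6) (# 1) ([2] ∷ [-1] ∷ [b] ∷ []) refl
      All.∷ notCollinear (# 3) (# 5) (# 6) (# 1) ([2] ∷ [2] ∷ [-1] ∷ [b] ∷ []) refl
      All.∷ notCollinear (# 4) (# 5) (# 6) (# 0) ([b-1] ∷ []) refl
      All.∷ All.[]

    notCovered : ∀ L₁ L₂ L₃ → ¬ All (InUnion3 F L₁ L₂ L₃) extended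
    notCovered L₁ L₂ L₃ covered = impossible (find (monochromatic-triple colour))
      where
      lineNo : Fin 3 → Line F
      lineNo Fin.zero = L₁
      lineNo (Fin.suc Fin.zero) = L₂
      lineNo (Fin.suc (Fin.suc Fin.zero)) = L₃

      located : ∀ {p} → InUnion3 F L₁ L₂ L₃ p → Σ (Fin 3) λ c → OnLine F (lineNo c) p
      located (inj₁ on) = # 0 , on
      located (inj₂ (inj₁ on)) = # 1 , on
      located (inj₂ (inj₂ on)) = # 2 , on

      colour : Fin 7 → Fin 3
      colour i = proj₁ (located (All.lookup covered (test∈ i)))

      onColouredLine : ∀ i → OnLine F (lineNo (colour i)) (test i)
      onColouredLine i = proj₂ (located (All.lookup covered (test∈ i)))

      onLineOf : ∀ i {j} → colour j ≡ colour i → OnLine F (lineNo (colour i)) (test j)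
      onLineOf i {j} same = subst (λ c → OnLine F (lineNo c) (test j)) same (onColouredLine j)

      impossible : (∃ λ t → t ∈ increasingTriples × Monochromatic colour t) → ⊥
      impossible ((i , j , k) , t∈ , j∼i , k∼i) = All.lookup noThreeCollinear t∈
        (onLine⇒collinear (lineNo (colour i)) (onColouredLine i) (onLineOf i {j} j∼i) (onLineOf i {k} k∼i))

  threeLineSet : ∃ λ L₁ → ∃ λ L₂ → ∃ λ L₃ → ∃ λ (S : List Pt) →
    Unique S × NonCommuting F S × All (InUnion3 F L₁ L₂ L₃) S × 3 ℕ.* size ∸ 3 ≤ length S
  threeLineSet with 3 ℕ.≤? size
  ... | yes 3≤q = threeRows 3≤q
  ... | no 3≰q = smallField (ℕP.≰⇒> 3≰q)

  beyondThreeLines : 3 < size → 1# + 1# ≢ 0# → ∃ λ (S : List Pt) →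
    Unique S × NonCommuting F S × length S ≡ 3 ℕ.* size ∸ 2 × (∀ L₁ L₂ L₃ → ¬ All (InUnion3 F L₁ L₂ L₃) S)
  beyondThreeLines 3<q 2≢0 with avoid 3<q standard
  ... | b , b-new = extended , extended-unique , extended-nonCommuting
    , trans extended-length (three-rows-plus-one (ℕP.≤-trans (s≤s z≤n) 3<q)) , notCovered
    where
    open SevenPoints 2≢0 b b-new

-- ℕ multiplication is opened unqualified only here, since inside Construction
-- `_*_` is the field's.
open import Data.Nat using (_*_)

lemma7p5 : (F : FiniteField) →
    (∃ λ L₁ → ∃ λ L₂ → ∃ λ L₃ → ∃ λ (S : List (Point F)) →
        Unique S × NonCommuting F S × All (InUnion3 F L₁ L₂ L₃) S
        × 3 * FiniteField.size F ∸ 3 ≤ length S)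
    × (3 < FiniteField.size F →
       FiniteField._+_ F (FiniteField.1# F) (FiniteField.1# F) ≢ FiniteField.0# F →
       ∃ λ (S : List (Point F)) →
         Unique S × NonCommuting F S × length S ≡ 3 * FiniteField.size F ∸ 2
         × (∀ L₁ L₂ L₃ → ¬ All (InUnion3 F L₁ L₂ L₃) S))
lemma7p5 F = threeLineSet , beyondThreeLines
  where
  open Construction F
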